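{- Let $k$ be a field and let $f(X,Y) \in k[X,Y]$ be a (not necessarily homogeneous) polynomial of total degree $d$ such that $f(X,0)$ has degree $d$ in $k[X]$ and has a simple root $\alpha_0 \in \overline{k}$. Let $\widetilde{\alpha} \in k(\alpha_0)[[Y]]$ be the unique power series with constant term $\alpha_0$ satisfying $f(\widetilde{\alpha}, Y) = 0$. Then $f$ factors over $\overline{k}$ as $f = g(X,Y)h(X,Y)$ with $\deg g = 1$ and $g(\alpha_0,0) = 0$ if and only if there exist $u_{0,0}, u_{0,1} \in k(\alpha_0)$ such that \[\widetilde{\alpha} + u_{0,0} + u_{0,1}Y \equiv 0 \pmod{Y^{d+1}}\] (i.e.\ the linear system below for $m=1$ has a solution in $k(\alpha_0)$).
   Context: For a positive integer $m$, the "linear system for $m$" is the system in unknowns $u_{\mu,\eta}$ ($0 \le \mu \le m-1$, $0 \le \eta \le m-\mu$) expressing that, with $h_\mu(Y) = \sum_{\eta=0}^{m-\mu} u_{\mu,\eta}Y^\eta$, one has $\widetilde{\alpha}^m + \sum_{\mu=0}^{m-1} h_\mu(Y)\widetilde{\alpha}^\mu \equiv 0 \pmod{Y^{dm+1}}$; comparing coefficients of $Y^r$ for $0 \le r \le dm$ gives linear equations in the $u_{\mu,\eta}$ with coefficients in $k(\alpha_0)$. The power series $\widetilde{\alpha}$ exists and is unique by Hensel's lemma since $\frac{\partial f}{\partial X}(\alpha_0,0) \neq 0$. -}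

module Defs where

open import Level using (Level; _⊔_) renaming (suc to lsuc)
open import Data.Nat as ℕ using (ℕ; zero; suc; _∸_)
open import Relation.Binary.PropositionalEquality using (_≡_)
open import Data.Product using (Σ; ∃; _×_; _,_)
open import Relation.Nullary using (¬_)
open import Algebra.Bundles using (CommutativeRing)

record Field (c ℓ : Level) : Set (lsuc (c ⊔ ℓ)) where
  field
    cring   : CommutativeRing c ℓ
  open CommutativeRing cring public
  field
    0≉1     : ¬ (0# ≈ 1#)
    inverse : ∀ x → ¬ (x ≈ 0#) → ∃ λ y → x * y ≈ 1#

module FieldTheory {c ℓ : Level} (K : Field c ℓ) where
  open Field K hiding (zero)

  Σ< : ℕ → (ℕ → Carrier) → Carrier
  Σ< zero    f = 0#
  Σ< (suc n) f = Σ< n f + f n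

  Σ≤ : ℕ → (ℕ → Carrier) → Carrier
  Σ≤ n f = Σ< (suc n) f

  pow : Carrier → ℕ → Carrier
  pow x zero    = 1#
  pow x (suc n) = pow x n * x

  _·_ : ℕ → Carrier → Carrier
  zero  · x = 0#
  suc n · x = n · x + x

  IsAlgebraicallyClosed : Set (c ⊔ ℓ)
  IsAlgebraicallyClosed =
    (n : ℕ) → (a : ℕ → Carrier) →
    ∃ λ x → pow x (suc n) + Σ< (suc n) (λ i → a i * pow x i) ≈ 0#

  record IsSubfield {ℓ' : Level} (k : Carrier → Set ℓ') : Set (c ⊔ ℓ ⊔ ℓ') where
    field
      resp  : ∀ {x y} → x ≈ y → k x → k y
      has0  : k 0#
      has1  : k 1#
      has+  : ∀ {x y} → k x → k y → k (x + y)
      has-  : ∀ {x} → k x → k (- x)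
      has*  : ∀ {x y} → k x → k y → k (x * y)
      hasInv : ∀ {x y} → k x → x * y ≈ 1# → k y

  IsAlgebraicOver : {ℓ' : Level} → (Carrier → Set ℓ') → Carrier → Set (c ⊔ ℓ ⊔ ℓ')
  IsAlgebraicOver k x =
    Σ ℕ λ n → Σ (ℕ → Carrier) λ a → (∀ i → k (a i)) ×
      (pow x (suc n) + Σ< (suc n) (λ i → a i * pow x i) ≈ 0#)

  Adjoin : {ℓ' : Level} → (Carrier → Set ℓ') → Carrier → Carrier → Set (c ⊔ ℓ ⊔ lsuc ℓ')
  Adjoin {ℓ'} k α x =
    (L : Carrier → Set ℓ') → IsSubfield L → (∀ {y} → k y → L y) → L α → L x

  -- bivariate polynomials in X, Y: coefficient functions (i , j) ↦ coeff of X^i Y^j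
  Poly2 : Set c
  Poly2 = ℕ → ℕ → Carrier

  TotDeg≤ : Poly2 → ℕ → Set ℓ
  TotDeg≤ f d = ∀ i j → d ℕ.< i ℕ.+ j → f i j ≈ 0#

  TotDeg≡ : Poly2 → ℕ → Set ℓ
  TotDeg≡ f d = TotDeg≤ f d × (Σ ℕ λ i → Σ ℕ λ j → (i ℕ.+ j ≡ d) × ¬ (f i j ≈ 0#))

  IsPolynomial : Poly2 → Set ℓ
  IsPolynomial f = Σ ℕ λ e → TotDeg≤ f e

  mul2 : Poly2 → Poly2 → Poly2
  mul2 g h a b = Σ≤ a λ i → Σ≤ b λ j → g i j * h (a ∸ i) (b ∸ j)

  _≈₂_ : Poly2 → Poly2 → Set ℓ
  f ≈₂ g = ∀ i j → f i j ≈ g i j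

  -- evaluation at a point, for a polynomial of total degree ≤ d
  eval2 : ℕ → Poly2 → Carrier → Carrier → Carrier
  eval2 d f x y = Σ≤ d λ i → Σ≤ d λ j → f i j * pow x i * pow y j

  Series : Set c
  Series = ℕ → Carrier

  _*ₛ_ : Series → Series → Series
  (s *ₛ t) n = Σ≤ n λ i → s i * t (n ∸ i)

  powₛ : Series → ℕ → Series
  powₛ s zero    = λ { zero → 1# ; (suc _) → 0# }
  powₛ s (suc n) = powₛ s n *ₛ s

  -- f(S , Y) as a power series, for f of total degree ≤ d
  subst2 : ℕ → Poly2 → Series → Series
  subst2 d f s n = Σ≤ d λ i → Σ≤ n λ j → f i j * powₛ s i (n ∸ j)

  addLin : Series → Carrier → Carrier → Series
  addLin s u₀ u₁ zero          = s zero + u₀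
  addLin s u₀ u₁ (suc zero)    = s (suc zero) + u₁
  addLin s u₀ u₁ (suc (suc n)) = s (suc (suc n))

-- If f = g h with g linear and g(α₀, 0) = 0, the X-coefficient of g is nonzero (otherwise g, and
-- with it f, would vanish at Y = 0), so g vanishes on a linear series β = α₀ + β₁Y and f(β, Y) = 0.
-- A root with constant term α₀ is unique: the (m+1)-st coefficient of f(s, Y) is ∂f/∂X(α₀, 0)·s_{m+1}
-- plus terms in s_0, …, s_m. Hence α̃ = β is linear. Conversely, if α̃ ≡ α₀ + α₁Y mod Y^{d+1}, then
-- f(α₀ + α₁Y, Y) has Y-degree at most d and vanishes mod Y^{d+1}, so it is 0; and synthetic division
-- of f by X − α₀ − α₁Y leaves exactly this remainder.
module Submission where

open import Defs
open import Level using (Level)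
open import Data.Nat as ℕ using (ℕ; zero; suc; _≤_; _<_; _∸_; z≤n; s≤s)
import Data.Nat.Properties as ℕₚ
open import Data.Product using (Σ; _×_; _,_; proj₁; proj₂)
open import Data.Sum using (inj₁; inj₂)
open import Relation.Nullary using (¬_; yes; no)
open import Relation.Binary.PropositionalEquality as ≡ using (_≡_)
open import Function.Bundles using (_⇔_; mk⇔)

∸-suc : ∀ {i n} → i < n → n ∸ i ≡ suc (n ∸ suc i)
∸-suc {zero}  {suc n} _         = ≡.refl
∸-suc {suc i} {suc n} (s≤s i<n) = ∸-suc i<n

m<m∸n+[1+o] : ∀ m {n o} → n ≤ o → m < (m ∸ n) ℕ.+ suc o
m<m∸n+[1+o] m {n} {o} n≤o = begin-strict
  m                   ≤⟨ ℕₚ.m≤n+m∸n m n ⟩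
  n ℕ.+ (m ∸ n)       ≤⟨ ℕₚ.+-monoˡ-≤ (m ∸ n) n≤o ⟩
  o ℕ.+ (m ∸ n)       <⟨ ℕₚ.n<1+n _ ⟩
  suc o ℕ.+ (m ∸ n)   ≡⟨ ℕₚ.+-comm (suc o) (m ∸ n) ⟩
  (m ∸ n) ℕ.+ suc o   ∎
  where open ℕₚ.≤-Reasoning

module FieldLemmas {c ℓ : Level} (K : Field c ℓ) where
  open Field K hiding (zero)
  open FieldTheory K
  open import Relation.Binary.Reasoning.Setoid setoid
  open import Algebra.Solver.Ring.NaturalCoefficients.Default commutativeSemiring
  open import Algebra.Properties.Ring ring using (-‿distribˡ-*; -‿distribʳ-*)

  Σ<-cong : ∀ n {F G : ℕ → Carrier} → (∀ i → i < n → F i ≈ G i) → Σ< n F ≈ Σ< n G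
  Σ<-cong zero    F≈G = refl
  Σ<-cong (suc n) F≈G = +-cong (Σ<-cong n (λ i i<n → F≈G i (ℕₚ.m<n⇒m<1+n i<n))) (F≈G n (ℕₚ.n<1+n n))

  Σ<-zero : ∀ n {F : ℕ → Carrier} → (∀ i → i < n → F i ≈ 0#) → Σ< n F ≈ 0#
  Σ<-zero zero    F≈0 = refl
  Σ<-zero (suc n) F≈0 = begin
    Σ< n _ + _  ≈⟨ +-cong (Σ<-zero n (λ i i<n → F≈0 i (ℕₚ.m<n⇒m<1+n i<n))) (F≈0 n (ℕₚ.n<1+n n)) ⟩
    0# + 0#     ≈⟨ +-identityˡ 0# ⟩
    0#          ∎

  Σ<-+ : ∀ n (F G : ℕ → Carrier) → Σ< n (λ i → F i + G i) ≈ Σ< n F + Σ< n G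
  Σ<-+ zero    F G = sym (+-identityˡ 0#)
  Σ<-+ (suc n) F G = begin
    Σ< n (λ i → F i + G i) + (F n + G n)    ≈⟨ +-congʳ (Σ<-+ n F G) ⟩
    (Σ< n F + Σ< n G) + (F n + G n)         ≈⟨ solve 4 (λ a b x y → (a :+ b) :+ (x :+ y) := (a :+ x) :+ (b :+ y))
                                                 refl (Σ< n F) (Σ< n G) (F n) (G n) ⟩
    (Σ< n F + F n) + (Σ< n G + G n)         ∎

  *-distribˡ-Σ< : ∀ n a (F : ℕ → Carrier) → a * Σ< n F ≈ Σ< n (λ i → a * F i)
  *-distribˡ-Σ< zero    a F = zeroʳ a
  *-distribˡ-Σ< (suc n) a F = trans (distribˡ a _ _) (+-congʳ (*-distribˡ-Σ< n a F))

  *-distribʳ-Σ< : ∀ n a (F : ℕ → Carrier) → Σ< n F * a ≈ Σ< n (λ i → F i * a)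
  *-distribʳ-Σ< n a F = trans (*-comm _ a) (trans (*-distribˡ-Σ< n a F) (Σ<-cong n (λ i _ → *-comm a (F i))))

  Σ<-head : ∀ n (F : ℕ → Carrier) → Σ< (suc n) F ≈ F 0 + Σ< n (λ i → F (suc i))
  Σ<-head zero    F = trans (+-identityˡ _) (sym (+-identityʳ _))
  Σ<-head (suc n) F = trans (+-congʳ (Σ<-head n F)) (+-assoc _ _ _)

  Σ<-lincomb : ∀ n a b (F G : ℕ → Carrier) →
               Σ< n (λ i → a * F i + b * G i) ≈ a * Σ< n F + b * Σ< n G
  Σ<-lincomb n a b F G = begin
    Σ< n (λ i → a * F i + b * G i)              ≈⟨ Σ<-+ n _ _ ⟩
    Σ< n (λ i → a * F i) + Σ< n (λ i → b * G i) ≈⟨ sym (+-cong (*-distribˡ-Σ< n a F) (*-distribˡ-Σ< n b G)) ⟩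
    a * Σ< n F + b * Σ< n G                     ∎

  Σ<-extend : ∀ {m n} (F : ℕ → Carrier) → m ≤ n → (∀ i → m ≤ i → F i ≈ 0#) → Σ< n F ≈ Σ< m F
  Σ<-extend F m≤n F≈0 with ℕₚ.m≤n⇒m<n∨m≡n m≤n
  ... | inj₂ ≡.refl = refl
  Σ<-extend {n = suc n} F _ F≈0 | inj₁ (s≤s m≤n) =
    trans (+-cong (Σ<-extend F m≤n F≈0) (F≈0 n m≤n)) (+-identityʳ _)

  mulYₛ : Series → Series
  mulYₛ s zero    = 0#
  mulYₛ s (suc n) = s n

  linₛ : Carrier → Carrier → Series
  linₛ β₀ β₁ zero          = β₀
  linₛ β₀ β₁ (suc zero)    = β₁
  linₛ β₀ β₁ (suc (suc _)) = 0#

  _≈ₛ_upTo_ : Series → Series → ℕ → Set ℓ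
  s ≈ₛ t upTo N = ∀ l → l ≤ N → s l ≈ t l

  mulYₛ-cong : ∀ {s t} → (∀ n → s n ≈ t n) → ∀ n → mulYₛ s n ≈ mulYₛ t n
  mulYₛ-cong s≈t zero    = refl
  mulYₛ-cong s≈t (suc n) = s≈t n

  Σ<-mulYₛ : ∀ D (F : ℕ → Series) n → Σ< D (λ i → mulYₛ (F i) n) ≈ mulYₛ (λ m → Σ< D (λ i → F i m)) n
  Σ<-mulYₛ D F zero    = Σ<-zero D (λ _ _ → refl)
  Σ<-mulYₛ D F (suc n) = refl

  *ₛ-zeroˡ : ∀ {s} t → (∀ j → s j ≈ 0#) → ∀ n → (s *ₛ t) n ≈ 0#
  *ₛ-zeroˡ t s≈0 n = Σ<-zero (suc n) (λ j _ → trans (*-congʳ (s≈0 j)) (zeroˡ _))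

  *ₛ-distribʳ-+ : ∀ s t u n → ((λ j → s j + t j) *ₛ u) n ≈ (s *ₛ u) n + (t *ₛ u) n
  *ₛ-distribʳ-+ s t u n = trans (Σ<-cong (suc n) (λ j _ → distribʳ _ (s j) (t j))) (Σ<-+ (suc n) _ _)

  *ₛ-scaleˡ : ∀ a s t n → ((λ j → a * s j) *ₛ t) n ≈ a * (s *ₛ t) n
  *ₛ-scaleˡ a s t n = trans (Σ<-cong (suc n) (λ j _ → *-assoc a (s j) _)) (sym (*-distribˡ-Σ< (suc n) a _))

  *ₛ-powₛ-zero : ∀ s t n → (s *ₛ powₛ t 0) n ≈ s n
  *ₛ-powₛ-zero s t n = begin
    Σ< n _ + s n * powₛ t 0 (n ∸ n) ≈⟨ +-cong (Σ<-zero n (λ j j<n → trans (*-congˡ (powₛ-zero-pos (ℕₚ.m<n⇒0<n∸m j<n))) (zeroʳ _)))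
                                              (*-congˡ (reflexive (≡.cong (powₛ t 0) (ℕₚ.n∸n≡0 n)))) ⟩
    0# + s n * 1#                   ≈⟨ trans (+-identityˡ _) (*-identityʳ _) ⟩
    s n                             ∎
    where
      powₛ-zero-pos : ∀ {m} → 0 < m → powₛ t 0 m ≈ 0#
      powₛ-zero-pos {suc m} _ = refl

  *ₛ-mulYₛˡ : ∀ s t n → (mulYₛ s *ₛ t) n ≈ mulYₛ (s *ₛ t) n
  *ₛ-mulYₛˡ s t zero    = trans (+-identityˡ _) (zeroˡ _)
  *ₛ-mulYₛˡ s t (suc n) = trans (Σ<-head (suc n) _) (trans (+-congʳ (zeroˡ _)) (+-identityˡ _))

  *ₛ-mulYₛʳ : ∀ s t n → (s *ₛ mulYₛ t) n ≈ mulYₛ (s *ₛ t) n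
  *ₛ-mulYₛʳ s t zero    = trans (+-identityˡ _) (zeroʳ _)
  *ₛ-mulYₛʳ s t (suc n) = begin
    Σ< (suc n) (λ j → s j * mulYₛ t (suc n ∸ j)) + s (suc n) * mulYₛ t (n ∸ n)
      ≈⟨ +-cong (Σ<-cong (suc n) (λ j j<sn → *-congˡ (reflexive (≡.cong (mulYₛ t) (ℕₚ.+-∸-assoc 1 (ℕₚ.≤-pred j<sn))))))
                (trans (*-congˡ (reflexive (≡.cong (mulYₛ t) (ℕₚ.n∸n≡0 n)))) (zeroʳ _)) ⟩
    Σ< (suc n) (λ j → s j * t (n ∸ j)) + 0#
      ≈⟨ +-identityʳ _ ⟩
    (s *ₛ t) n ∎

  *ₛ-linₛ : ∀ s β₀ β₁ n → (s *ₛ linₛ β₀ β₁) n ≈ β₀ * s n + β₁ * mulYₛ s n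
  *ₛ-linₛ s β₀ β₁ zero = begin
    0# + s 0 * β₀       ≈⟨ trans (+-identityˡ _) (*-comm _ _) ⟩
    β₀ * s 0            ≈⟨ sym (trans (+-congˡ (zeroʳ β₁)) (+-identityʳ _)) ⟩
    β₀ * s 0 + β₁ * 0#  ∎
  *ₛ-linₛ s β₀ β₁ (suc n) = begin
    (Σ< n F + F n) + F (suc n)
      ≈⟨ +-cong (+-cong (Σ<-zero n (λ j j<n → trans (*-congˡ (vanish (ℕₚ.m+n≤o⇒m≤o∸n 2 (s≤s j<n)))) (zeroʳ _)))
                        (*-congˡ (reflexive (≡.cong (linₛ β₀ β₁) (ℕₚ.m+n∸n≡m 1 n)))))
                (*-congˡ (reflexive (≡.cong (linₛ β₀ β₁) (ℕₚ.n∸n≡0 n)))) ⟩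
    (0# + s n * β₁) + s (suc n) * β₀
      ≈⟨ +-congʳ (+-identityˡ _) ⟩
    s n * β₁ + s (suc n) * β₀
      ≈⟨ solve 4 (λ x y b₀ b₁ → x :* b₁ :+ y :* b₀ := b₀ :* y :+ b₁ :* x) refl (s n) (s (suc n)) β₀ β₁ ⟩
    β₀ * s (suc n) + β₁ * s n ∎
    where
      F : ℕ → Carrier
      F j = s j * linₛ β₀ β₁ (suc n ∸ j)
      vanish : ∀ {k} → 2 ≤ k → linₛ β₀ β₁ k ≈ 0#
      vanish (s≤s (s≤s _)) = refl

  powₛ-linₛ-vanish : ∀ β₀ β₁ i m → i < m → powₛ (linₛ β₀ β₁) i m ≈ 0#
  powₛ-linₛ-vanish β₀ β₁ zero    (suc m) _         = refl
  powₛ-linₛ-vanish β₀ β₁ (suc i) (suc m) (s≤s i<m) = begin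
    (P *ₛ linₛ β₀ β₁) (suc m)       ≈⟨ *ₛ-linₛ P β₀ β₁ (suc m) ⟩
    β₀ * P (suc m) + β₁ * P m       ≈⟨ +-cong (*-congˡ (powₛ-linₛ-vanish β₀ β₁ i (suc m) (ℕₚ.m<n⇒m<1+n i<m)))
                                              (*-congˡ (powₛ-linₛ-vanish β₀ β₁ i m i<m)) ⟩
    β₀ * 0# + β₁ * 0#               ≈⟨ trans (+-cong (zeroʳ β₀) (zeroʳ β₁)) (+-identityˡ 0#) ⟩
    0#                              ∎
    where
      P : Series
      P = powₛ (linₛ β₀ β₁) i

  powₛ-cong-upTo : ∀ {s t N} → s ≈ₛ t upTo N → ∀ i → powₛ s i ≈ₛ powₛ t i upTo N
  powₛ-cong-upTo s≈t zero    zero    _   = refl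
  powₛ-cong-upTo s≈t zero    (suc l) _   = refl
  powₛ-cong-upTo s≈t (suc i) l l≤N = Σ<-cong (suc l) (λ k k<sl →
    *-cong (powₛ-cong-upTo s≈t i k (ℕₚ.≤-trans (ℕₚ.≤-pred k<sl) l≤N))
           (s≈t (l ∸ k) (ℕₚ.≤-trans (ℕₚ.m∸n≤m l k) l≤N)))

  powₛ-constant-term : ∀ {s α} → s 0 ≈ α → ∀ i → powₛ s i 0 ≈ pow α i
  powₛ-constant-term s₀≈α zero    = refl
  powₛ-constant-term s₀≈α (suc i) = trans (+-identityˡ _) (*-cong (powₛ-constant-term s₀≈α i) s₀≈α)

  *ₛ-linₛ-assoc : ∀ u t β₀ β₁ n → (u *ₛ (t *ₛ linₛ β₀ β₁)) n ≈ ((u *ₛ t) *ₛ linₛ β₀ β₁) n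
  *ₛ-linₛ-assoc u t β₀ β₁ n = begin
    Σ≤ n (λ j → u j * (t *ₛ linₛ β₀ β₁) (n ∸ j))
      ≈⟨ Σ<-cong (suc n) (λ j _ → trans (*-congˡ (*ₛ-linₛ t β₀ β₁ (n ∸ j)))
           (solve 5 (λ u b₀ x b₁ y → u :* (b₀ :* x :+ b₁ :* y) := b₀ :* (u :* x) :+ b₁ :* (u :* y))
                  refl (u j) β₀ (t (n ∸ j)) β₁ (mulYₛ t (n ∸ j)))) ⟩
    Σ≤ n (λ j → β₀ * (u j * t (n ∸ j)) + β₁ * (u j * mulYₛ t (n ∸ j)))
      ≈⟨ Σ<-lincomb (suc n) β₀ β₁ _ _ ⟩
    β₀ * (u *ₛ t) n + β₁ * (u *ₛ mulYₛ t) n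
      ≈⟨ +-congˡ (*-congˡ (*ₛ-mulYₛʳ u t n)) ⟩
    β₀ * (u *ₛ t) n + β₁ * mulYₛ (u *ₛ t) n
      ≈⟨ sym (*ₛ-linₛ (u *ₛ t) β₀ β₁ n) ⟩
    ((u *ₛ t) *ₛ linₛ β₀ β₁) n ∎

  infixl 6 _+₂_
  infixr 7 _∙₂_

  _+₂_ : Poly2 → Poly2 → Poly2
  (f +₂ g) i j = f i j + g i j

  _∙₂_ : Carrier → Poly2 → Poly2
  (a ∙₂ f) i j = a * f i j

  mulX : Poly2 → Poly2
  mulX f zero    j = 0#
  mulX f (suc i) j = f i j

  mulY : Poly2 → Poly2
  mulY f i = mulYₛ (f i)

  constX : Series → Poly2
  constX r zero    j = r j
  constX r (suc i) j = 0#

  Σ≤-support₁ : ∀ n (F : ℕ → Carrier) → (∀ i → F (suc i) ≈ 0#) → Σ≤ n F ≈ F 0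
  Σ≤-support₁ n F F≈0 = trans (Σ<-head n F) (trans (+-congˡ (Σ<-zero n (λ i _ → F≈0 i))) (+-identityʳ _))

  Σ≤-support₂ : ∀ n (F : ℕ → Carrier) → (∀ i → F (suc (suc i)) ≈ 0#) → Σ≤ n F ≈ F 0 + mulYₛ (λ _ → F 1) n
  Σ≤-support₂ zero    F F≈0 = trans (+-identityˡ _) (sym (+-identityʳ _))
  Σ≤-support₂ (suc n) F F≈0 = trans (Σ<-head (suc n) F) (+-congˡ (Σ≤-support₁ n (λ i → F (suc i)) F≈0))

  mul2-linearˡ : ∀ g h → TotDeg≤ g 1 → mul2 g h ≈₂ ((g 0 0 ∙₂ h +₂ g 0 1 ∙₂ mulY h) +₂ g 1 0 ∙₂ mulX h)
  mul2-linearˡ g h g≤1 x y = begin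
    Σ≤ x (row x)                                                       ≈⟨ Σ≤-support₂ x (row x) row≥2 ⟩
    row x 0 + mulYₛ (λ _ → row x 1) x                                  ≈⟨ +-cong row₀ (row₁ x) ⟩
    (g 0 0 * h x y + g 0 1 * mulY h x y) + g 1 0 * mulX h x y          ∎
    where
      g≈0 : ∀ {i j} → 1 < i ℕ.+ j → g i j ≈ 0#
      g≈0 = g≤1 _ _
      row : ℕ → ℕ → Carrier
      row x′ i = Σ≤ y (λ j → g i j * h (x′ ∸ i) (y ∸ j))
      row≥2 : ∀ i → row x (suc (suc i)) ≈ 0#
      row≥2 i = Σ<-zero (suc y) (λ j _ → trans (*-congʳ (g≈0 (s≤s (s≤s z≤n)))) (zeroˡ _))
      row₀ : row x 0 ≈ g 0 0 * h x y + g 0 1 * mulY h x y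
      row₀ = trans (Σ≤-support₂ y _ (λ j → trans (*-congʳ (g≈0 (s≤s (s≤s z≤n)))) (zeroˡ _)))
                   (+-congˡ (column y))
        where
          column : ∀ y′ → mulYₛ (λ _ → g 0 1 * h x (y′ ∸ 1)) y′ ≈ g 0 1 * mulY h x y′
          column zero     = sym (zeroʳ _)
          column (suc y′) = refl
      row₁ : ∀ x′ → mulYₛ (λ _ → row x′ 1) x′ ≈ g 1 0 * mulX h x′ y
      row₁ zero     = sym (zeroʳ _)
      row₁ (suc x′) = Σ≤-support₁ y _ (λ j → trans (*-congʳ (g≈0 (s≤s (s≤s z≤n)))) (zeroˡ _))

  mul2-Y-divisible : ∀ g h → TotDeg≤ g 1 → g 0 0 ≈ 0# → g 1 0 ≈ 0# → ∀ i → mul2 g h i 0 ≈ 0#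
  mul2-Y-divisible g h g≤1 g₀₀≈0 g₁₀≈0 i = begin
    mul2 g h i 0                                        ≈⟨ mul2-linearˡ g h g≤1 i 0 ⟩
    (g 0 0 * h i 0 + g 0 1 * 0#) + g 1 0 * mulX h i 0   ≈⟨ +-cong (+-cong (*-congʳ g₀₀≈0) (zeroʳ _)) (*-congʳ g₁₀≈0) ⟩
    (0# * h i 0 + 0#) + 0# * mulX h i 0                 ≈⟨ trans (+-cong (trans (+-identityʳ _) (zeroˡ _)) (zeroˡ _))
                                                                  (+-identityˡ 0#) ⟩
    0#                                                  ∎

  eval2-linear : ∀ g x → eval2 1 g x 0# ≈ g 0 0 + g 1 0 * x
  eval2-linear g x = begin
      (0# + (0# + g 0 0 * 1# * 1# + g 0 1 * 1# * (1# * 0#)))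
        + (0# + g 1 0 * (1# * x) * 1# + g 1 1 * (1# * x) * (1# * 0#))
    ≈⟨ +-cong (trans (+-identityˡ _) (+-cong (trans (+-identityˡ _) (trans (*-identityʳ _) (*-identityʳ _))) Y≈0))
              (+-cong (trans (+-identityˡ _) (trans (*-identityʳ _) (*-congˡ (*-identityˡ x)))) Y≈0) ⟩
      (g 0 0 + 0#) + (g 1 0 * x + 0#)
    ≈⟨ +-cong (+-identityʳ _) (+-identityʳ _) ⟩
      g 0 0 + g 1 0 * x ∎
    where
      Y≈0 : ∀ {u} → u * (1# * 0#) ≈ 0#
      Y≈0 {u} = trans (*-congˡ (zeroʳ 1#)) (zeroʳ u)

  TotDeg≤-rows : ∀ {f d} → TotDeg≤ f d → ∀ i j → d < i → f i j ≈ 0#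
  TotDeg≤-rows f≤d i j d<i = f≤d i j (ℕₚ.<-≤-trans d<i (ℕₚ.m≤m+n i j))

  subst2-cong : ∀ D {f g} s n → f ≈₂ g → subst2 D f s n ≈ subst2 D g s n
  subst2-cong D s n f≈g = Σ<-cong (suc D) (λ i _ → Σ<-cong (suc n) (λ j _ → *-congʳ (f≈g i j)))

  subst2-+₂ : ∀ D f g s n → subst2 D (f +₂ g) s n ≈ subst2 D f s n + subst2 D g s n
  subst2-+₂ D f g s n =
    trans (Σ<-cong (suc D) (λ i _ → *ₛ-distribʳ-+ (f i) (g i) (powₛ s i) n)) (Σ<-+ (suc D) _ _)

  subst2-∙₂ : ∀ D a f s n → subst2 D (a ∙₂ f) s n ≈ a * subst2 D f s n
  subst2-∙₂ D a f s n =
    trans (Σ<-cong (suc D) (λ i _ → *ₛ-scaleˡ a (f i) (powₛ s i) n)) (sym (*-distribˡ-Σ< (suc D) a _))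

  subst2-mulY : ∀ D f s n → subst2 D (mulY f) s n ≈ mulYₛ (subst2 D f s) n
  subst2-mulY D f s n =
    trans (Σ<-cong (suc D) (λ i _ → *ₛ-mulYₛˡ (f i) (powₛ s i) n)) (Σ<-mulYₛ (suc D) (λ i → f i *ₛ powₛ s i) n)

  subst2-mulX-linₛ : ∀ D f β₀ β₁ n →
    subst2 (suc D) (mulX f) (linₛ β₀ β₁) n ≈ β₀ * subst2 D f (linₛ β₀ β₁) n + β₁ * mulYₛ (subst2 D f (linₛ β₀ β₁)) n
  subst2-mulX-linₛ D f β₀ β₁ n = begin
    subst2 (suc D) (mulX f) β n
      ≈⟨ Σ<-head (suc D) _ ⟩
    (mulX f 0 *ₛ P 0) n + Σ≤ D (λ i → (f i *ₛ (P i *ₛ β)) n)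
      ≈⟨ trans (+-congʳ (*ₛ-zeroˡ (P 0) (λ _ → refl) n)) (+-identityˡ _) ⟩
    Σ≤ D (λ i → (f i *ₛ (P i *ₛ β)) n)
      ≈⟨ Σ<-cong (suc D) (λ i _ → trans (*ₛ-linₛ-assoc (f i) (P i) β₀ β₁ n) (*ₛ-linₛ (f i *ₛ P i) β₀ β₁ n)) ⟩
    Σ≤ D (λ i → β₀ * (f i *ₛ P i) n + β₁ * mulYₛ (f i *ₛ P i) n)
      ≈⟨ Σ<-lincomb (suc D) β₀ β₁ _ _ ⟩
    β₀ * subst2 D f β n + β₁ * Σ≤ D (λ i → mulYₛ (f i *ₛ P i) n)
      ≈⟨ +-congˡ (*-congˡ (Σ<-mulYₛ (suc D) (λ i → f i *ₛ P i) n)) ⟩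
    β₀ * subst2 D f β n + β₁ * mulYₛ (subst2 D f β) n ∎
    where
      β : Series
      β = linₛ β₀ β₁
      P : ℕ → Series
      P = powₛ β

  subst2-constX : ∀ D r s n → subst2 D (constX r) s n ≈ r n
  subst2-constX D r s n =
    trans (Σ≤-support₁ D _ (λ i → *ₛ-zeroˡ (powₛ s (suc i)) (λ _ → refl) n)) (*ₛ-powₛ-zero r s n)

  subst2-extend : ∀ {d D} f s n → d ≤ D → (∀ i j → d < i → f i j ≈ 0#) → subst2 D f s n ≈ subst2 d f s n
  subst2-extend f s n d≤D f≈0 = Σ<-extend _ (s≤s d≤D) (λ i d<i → *ₛ-zeroˡ (powₛ s i) (λ j → f≈0 i j d<i) n)

  subst2-cong-upTo : ∀ d f {s t N} → s ≈ₛ t upTo N → ∀ n → n ≤ N → subst2 d f s n ≈ subst2 d f t n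
  subst2-cong-upTo d f s≈t n n≤N = Σ<-cong (suc d) (λ i _ → Σ<-cong (suc n) (λ j _ →
    *-congˡ (powₛ-cong-upTo s≈t i (n ∸ j) (ℕₚ.≤-trans (ℕₚ.m∸n≤m n j) n≤N))))

  subst2-linₛ-vanish : ∀ {d} f β₀ β₁ → TotDeg≤ f d → ∀ n → d < n → subst2 d f (linₛ β₀ β₁) n ≈ 0#
  subst2-linₛ-vanish {d} f β₀ β₁ f≤d n d<n = Σ<-zero (suc d) (λ i _ → Σ<-zero (suc n) (λ j _ → term i j))
    where
      term : ∀ i j → f i j * powₛ (linₛ β₀ β₁) i (n ∸ j) ≈ 0#
      term i j with d ℕ.<? i ℕ.+ j
      ... | yes d<i+j = trans (*-congʳ (f≤d i j d<i+j)) (zeroˡ _)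
      ... | no  d≮i+j = trans (*-congˡ (powₛ-linₛ-vanish β₀ β₁ i (n ∸ j)
                          (ℕₚ.m+n≤o⇒m≤o∸n (suc i) (ℕₚ.≤-<-trans (ℕₚ.≮⇒≥ d≮i+j) d<n)))) (zeroʳ _)

  subst2-mul2-linₛ-root : ∀ D g h β₀ β₁ → TotDeg≤ g 1 → (∀ j → h (suc D) j ≈ 0#) →
    g 0 0 + g 1 0 * β₀ ≈ 0# → g 0 1 + g 1 0 * β₁ ≈ 0# →
    ∀ n → subst2 (suc D) (mul2 g h) (linₛ β₀ β₁) n ≈ 0#
  subst2-mul2-linₛ-root D g h β₀ β₁ g≤1 h-top≈0 root₀ root₁ n = begin
    subst2 (suc D) (mul2 g h) β n
      ≈⟨ subst2-cong (suc D) β n (mul2-linearˡ g h g≤1) ⟩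
    subst2 (suc D) ((g₀₀ ∙₂ h +₂ g₀₁ ∙₂ mulY h) +₂ g₁₀ ∙₂ mulX h) β n
      ≈⟨ trans (subst2-+₂ (suc D) _ _ β n) (+-cong (subst2-+₂ (suc D) _ _ β n) (subst2-∙₂ (suc D) g₁₀ _ β n)) ⟩
    subst2 (suc D) (g₀₀ ∙₂ h) β n + subst2 (suc D) (g₀₁ ∙₂ mulY h) β n + g₁₀ * subst2 (suc D) (mulX h) β n
      ≈⟨ +-cong (+-cong (trans (subst2-∙₂ (suc D) g₀₀ h β n) (*-congˡ (h-trunc n)))
                        (trans (subst2-∙₂ (suc D) g₀₁ _ β n)
                               (*-congˡ (trans (subst2-mulY (suc D) h β n) (mulYₛ-cong h-trunc n)))))
                (*-congˡ (subst2-mulX-linₛ D h β₀ β₁ n)) ⟩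
    g₀₀ * H n + g₀₁ * mulYₛ H n + g₁₀ * (β₀ * H n + β₁ * mulYₛ H n)
      ≈⟨ solve 7 (λ c b a b₀ b₁ x y → c :* x :+ b :* y :+ a :* (b₀ :* x :+ b₁ :* y)
                                     := (c :+ a :* b₀) :* x :+ (b :+ a :* b₁) :* y)
               refl g₀₀ g₀₁ g₁₀ β₀ β₁ (H n) (mulYₛ H n) ⟩
    (g₀₀ + g₁₀ * β₀) * H n + (g₀₁ + g₁₀ * β₁) * mulYₛ H n
      ≈⟨ +-cong (trans (*-congʳ root₀) (zeroˡ _)) (trans (*-congʳ root₁) (zeroˡ _)) ⟩
    0# + 0#
      ≈⟨ +-identityˡ 0# ⟩
    0# ∎
    where
      g₀₀ g₀₁ g₁₀ : Carrier
      g₀₀ = g 0 0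
      g₀₁ = g 0 1
      g₁₀ = g 1 0
      β H : Series
      β = linₛ β₀ β₁
      H = subst2 D h β
      h-trunc : ∀ m → subst2 (suc D) h β m ≈ H m
      h-trunc m = trans (+-congˡ (*ₛ-zeroˡ (powₛ β (suc D)) h-top≈0 m)) (+-identityʳ _)

  ·-*-assoc : ∀ n x y → (n · x) * y ≈ n · (x * y)
  ·-*-assoc zero    x y = zeroˡ y
  ·-*-assoc (suc n) x y = trans (distribʳ y (n · x) x) (+-congʳ (·-*-assoc n x y))

  ·-cong : ∀ n {x y} → x ≈ y → n · x ≈ n · y
  ·-cong zero    _   = refl
  ·-cong (suc n) x≈y = +-cong (·-cong n x≈y) x≈y

  derivPow : Carrier → ℕ → Carrier
  derivPow α zero    = 0#
  derivPow α (suc i) = suc i · pow α i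

  derivPow-suc : ∀ α i → derivPow α (suc i) ≈ derivPow α i * α + pow α i
  derivPow-suc α zero    = +-congʳ (sym (zeroˡ α))
  derivPow-suc α (suc i) = +-congʳ (sym (·-*-assoc (suc i) (pow α i) α))

  derivX₀ : ℕ → Poly2 → Carrier → Carrier
  derivX₀ d f α = Σ≤ d (λ i → f i 0 * derivPow α i)

  derivX₀-expand : ∀ d f α → derivX₀ d f α ≈ Σ< d (λ i → (suc i · f (suc i) 0) * pow α i)
  derivX₀-expand d f α = begin
    Σ≤ d (λ i → f i 0 * derivPow α i)
      ≈⟨ Σ<-head d _ ⟩
    f 0 0 * 0# + Σ< d (λ i → f (suc i) 0 * (suc i · pow α i))
      ≈⟨ trans (+-congʳ (zeroʳ _)) (+-identityˡ _) ⟩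
    Σ< d (λ i → f (suc i) 0 * (suc i · pow α i))
      ≈⟨ Σ<-cong d (λ i _ → trans (*-comm _ _) (trans (·-*-assoc (suc i) _ _)
           (trans (·-cong (suc i) (*-comm _ _)) (sym (·-*-assoc (suc i) _ _))))) ⟩
    Σ< d (λ i → (suc i · f (suc i) 0) * pow α i) ∎

  -- Coefficient m+1 of s^i is i α^(i-1) s_{m+1} plus a polynomial in s_0, …, s_m; the statement
  -- compares s with t crosswise so that no subtraction occurs and both sides are semiring expressions.
  powₛ-coeff-suc : ∀ {s t α} m → s 0 ≈ α → t 0 ≈ α → s ≈ₛ t upTo m → ∀ i →
    powₛ s i (suc m) + derivPow α i * t (suc m) ≈ powₛ t i (suc m) + derivPow α i * s (suc m)
  powₛ-coeff-suc m s₀≈α t₀≈α s≈t zero = +-congˡ (trans (zeroˡ _) (sym (zeroˡ _)))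
  powₛ-coeff-suc {s} {t} {α} m s₀≈α t₀≈α s≈t (suc i) = begin
    powₛ s (suc i) (suc m) + derivPow α (suc i) * t (suc m)
      ≈⟨ expand s t s₀≈α s≈t ⟩
    (M + (p * s (suc m) + p * t (suc m))) + (powₛ s i (suc m) + Y * t (suc m)) * α
      ≈⟨ +-cong (+-congˡ (+-comm _ _)) (*-congʳ (powₛ-coeff-suc m s₀≈α t₀≈α s≈t i)) ⟩
    (M + (p * t (suc m) + p * s (suc m))) + (powₛ t i (suc m) + Y * s (suc m)) * α
      ≈⟨ sym (expand t s t₀≈α (λ _ _ → refl)) ⟩
    powₛ t (suc i) (suc m) + derivPow α (suc i) * s (suc m) ∎
    where
      p Y M : Carrier
      p = pow α i
      Y = derivPow α i
      M = Σ< m (λ k → powₛ t i (suc k) * t (m ∸ k))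
      expand : ∀ u v → u 0 ≈ α → u ≈ₛ t upTo m →
        powₛ u (suc i) (suc m) + derivPow α (suc i) * v (suc m)
          ≈ (M + (p * u (suc m) + p * v (suc m))) + (powₛ u i (suc m) + Y * v (suc m)) * α
      expand u v u₀≈α u≈t = begin
        (Σ< (suc m) (λ k → powₛ u i k * u (suc m ∸ k)) + powₛ u i (suc m) * u (m ∸ m))
          + derivPow α (suc i) * v (suc m)
          ≈⟨ +-cong (+-cong (Σ<-head m _) (*-congˡ (trans (reflexive (≡.cong u (ℕₚ.n∸n≡0 m))) u₀≈α)))
                    (*-congʳ (derivPow-suc α i)) ⟩
        ((powₛ u i 0 * u (suc m) + Σ< m (λ k → powₛ u i (suc k) * u (m ∸ k))) + powₛ u i (suc m) * α)
          + (Y * α + p) * v (suc m)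
          ≈⟨ +-congʳ (+-congʳ (+-cong (*-congʳ (powₛ-constant-term u₀≈α i))
               (Σ<-cong m (λ k k<m → *-cong (powₛ-cong-upTo u≈t i (suc k) k<m) (u≈t (m ∸ k) (ℕₚ.m∸n≤m m k)))))) ⟩
        ((p * u (suc m) + M) + powₛ u i (suc m) * α) + (Y * α + p) * v (suc m)
          ≈⟨ solve 7 (λ p u′ v′ M U Y α → ((p :* u′ :+ M) :+ U :* α) :+ (Y :* α :+ p) :* v′
                                         := (M :+ (p :* u′ :+ p :* v′)) :+ (U :+ Y :* v′) :* α)
                   refl p (u (suc m)) (v (suc m)) M (powₛ u i (suc m)) Y α ⟩
        (M + (p * u (suc m) + p * v (suc m))) + (powₛ u i (suc m) + Y * v (suc m)) * α ∎

  subst2-coeff-suc : ∀ d f {s t α} m → s 0 ≈ α → t 0 ≈ α → s ≈ₛ t upTo m →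
    subst2 d f s (suc m) + derivX₀ d f α * t (suc m) ≈ subst2 d f t (suc m) + derivX₀ d f α * s (suc m)
  subst2-coeff-suc d f {s} {t} {α} m s₀≈α t₀≈α s≈t = begin
    subst2 d f s (suc m) + derivX₀ d f α * t (suc m)
      ≈⟨ split s t ⟩
    Σ≤ d (λ i → (f i *ₛ powₛ s i) (suc m) + (f i 0 * derivPow α i) * t (suc m))
      ≈⟨ Σ<-cong (suc d) (λ i _ → trans (regroup i s t s≈t)
           (trans (+-congˡ (*-congˡ (powₛ-coeff-suc m s₀≈α t₀≈α s≈t i))) (sym (regroup i t s (λ _ _ → refl))))) ⟩
    Σ≤ d (λ i → (f i *ₛ powₛ t i) (suc m) + (f i 0 * derivPow α i) * s (suc m))
      ≈⟨ sym (split t s) ⟩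
    subst2 d f t (suc m) + derivX₀ d f α * s (suc m) ∎
    where
      split : ∀ u v → subst2 d f u (suc m) + derivX₀ d f α * v (suc m)
                        ≈ Σ≤ d (λ i → (f i *ₛ powₛ u i) (suc m) + (f i 0 * derivPow α i) * v (suc m))
      split u v = sym (trans (Σ<-+ (suc d) _ _) (+-congˡ (sym (*-distribʳ-Σ< (suc d) (v (suc m)) _))))
      R : ℕ → Carrier
      R i = Σ< (suc m) (λ j → f i (suc j) * powₛ t i (m ∸ j))
      regroup : ∀ i u v → u ≈ₛ t upTo m →
        (f i *ₛ powₛ u i) (suc m) + (f i 0 * derivPow α i) * v (suc m)
          ≈ R i + f i 0 * (powₛ u i (suc m) + derivPow α i * v (suc m))
      regroup i u v u≈t = begin
        (f i *ₛ powₛ u i) (suc m) + (f i 0 * derivPow α i) * v (suc m)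
          ≈⟨ +-congʳ (trans (Σ<-head (suc m) _) (+-congˡ (Σ<-cong (suc m) (λ j _ →
               *-congˡ (powₛ-cong-upTo u≈t i (m ∸ j) (ℕₚ.m∸n≤m m j)))))) ⟩
        (f i 0 * powₛ u i (suc m) + R i) + (f i 0 * derivPow α i) * v (suc m)
          ≈⟨ solve 5 (λ a P r Y v′ → (a :* P :+ r) :+ (a :* Y) :* v′ := r :+ a :* (P :+ Y :* v′))
                   refl (f i 0) (powₛ u i (suc m)) (R i) (derivPow α i) (v (suc m)) ⟩
        R i + f i 0 * (powₛ u i (suc m) + derivPow α i * v (suc m)) ∎

  *-cancelˡ : ∀ {x y z} → ¬ (x ≈ 0#) → x * y ≈ x * z → y ≈ z
  *-cancelˡ {x} {y} {z} x≉0 xy≈xz with inverse x x≉0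
  ... | x⁻¹ , xx⁻¹≈1 = begin
    y                ≈⟨ sym (trans (*-congʳ xx⁻¹≈1) (*-identityˡ y)) ⟩
    (x * x⁻¹) * y    ≈⟨ solve 3 (λ x w y → (x :* w) :* y := w :* (x :* y)) refl x x⁻¹ y ⟩
    x⁻¹ * (x * y)    ≈⟨ *-congˡ xy≈xz ⟩
    x⁻¹ * (x * z)    ≈⟨ solve 3 (λ x w z → w :* (x :* z) := (x :* w) :* z) refl x x⁻¹ z ⟩
    (x * x⁻¹) * z    ≈⟨ trans (*-congʳ xx⁻¹≈1) (*-identityˡ z) ⟩
    z                ∎

  roots-agree-next : ∀ d f {s t α} m → s 0 ≈ α → t 0 ≈ α → ¬ (derivX₀ d f α ≈ 0#) →
    subst2 d f s (suc m) ≈ 0# → subst2 d f t (suc m) ≈ 0# → s ≈ₛ t upTo m → s (suc m) ≈ t (suc m)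
  roots-agree-next d f {s} {t} {α} m s₀≈α t₀≈α f′≉0 s-root t-root s≈t = sym (*-cancelˡ f′≉0 (begin
    derivX₀ d f α * t (suc m)                         ≈⟨ sym (trans (+-congʳ s-root) (+-identityˡ _)) ⟩
    subst2 d f s (suc m) + derivX₀ d f α * t (suc m)  ≈⟨ subst2-coeff-suc d f m s₀≈α t₀≈α s≈t ⟩
    subst2 d f t (suc m) + derivX₀ d f α * s (suc m)  ≈⟨ trans (+-congʳ t-root) (+-identityˡ _) ⟩
    derivX₀ d f α * s (suc m)                         ∎))

  roots-unique : ∀ d f {s t α} → s 0 ≈ α → t 0 ≈ α → ¬ (derivX₀ d f α ≈ 0#) →
    (∀ n → subst2 d f s n ≈ 0#) → (∀ n → subst2 d f t n ≈ 0#) → ∀ n → s ≈ₛ t upTo n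
  roots-unique d f s₀≈α t₀≈α f′≉0 s-root t-root zero zero _ = trans s₀≈α (sym t₀≈α)
  roots-unique d f s₀≈α t₀≈α f′≉0 s-root t-root (suc m) l l≤1+m with ℕₚ.m≤n⇒m<n∨m≡n l≤1+m
  ... | inj₁ l<1+m  = roots-unique d f s₀≈α t₀≈α f′≉0 s-root t-root m l (ℕₚ.≤-pred l<1+m)
  ... | inj₂ ≡.refl = roots-agree-next d f m s₀≈α t₀≈α f′≉0 (s-root (suc m)) (t-root (suc m))
                        (roots-unique d f s₀≈α t₀≈α f′≉0 s-root t-root m)

  linearFactor : Carrier → Carrier → Poly2
  linearFactor β₀ β₁ zero          zero          = - β₀
  linearFactor β₀ β₁ zero          (suc zero)    = - β₁
  linearFactor β₀ β₁ zero          (suc (suc _)) = 0#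
  linearFactor β₀ β₁ (suc zero)    zero          = 1#
  linearFactor β₀ β₁ (suc zero)    (suc _)       = 0#
  linearFactor β₀ β₁ (suc (suc _)) _             = 0#

  linearFactor-degree : ∀ β₀ β₁ → TotDeg≡ (linearFactor β₀ β₁) 1
  linearFactor-degree β₀ β₁ = degree≤1 , 1 , 0 , ≡.refl , λ 1≈0 → 0≉1 (sym 1≈0)
    where
      degree≤1 : TotDeg≤ (linearFactor β₀ β₁) 1
      degree≤1 zero          (suc (suc _)) _ = refl
      degree≤1 (suc zero)    (suc _)       _ = refl
      degree≤1 (suc (suc _)) _             _ = refl
      degree≤1 zero          zero          ()
      degree≤1 zero          (suc zero)    (s≤s ())
      degree≤1 (suc zero)    zero          (s≤s ())

  -x+1#*x≈0 : ∀ x → - x + 1# * x ≈ 0#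
  -x+1#*x≈0 x = trans (+-congˡ (*-identityˡ x)) (-‿inverseˡ x)

  linearFactor-root : ∀ β₀ β₁ → eval2 1 (linearFactor β₀ β₁) β₀ 0# ≈ 0#
  linearFactor-root β₀ β₁ = trans (eval2-linear (linearFactor β₀ β₁) β₀) (-x+1#*x≈0 β₀)

  -‿cancel : ∀ F x y A B → (- x * A + - y * B) + (F + (x * A + y * B)) ≈ F
  -‿cancel F x y A B = begin
    (- x * A + - y * B) + (F + (x * A + y * B))
      ≈⟨ +-congʳ (+-cong (sym (-‿distribˡ-* x A)) (sym (-‿distribˡ-* y B))) ⟩
    (- (x * A) + - (y * B)) + (F + (x * A + y * B))
      ≈⟨ solve 5 (λ a′ b′ F a b → (a′ :+ b′) :+ (F :+ (a :+ b)) := F :+ ((a :+ a′) :+ (b :+ b′)))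
               refl (- (x * A)) (- (y * B)) F (x * A) (y * B) ⟩
    F + ((x * A + - (x * A)) + (y * B + - (y * B)))
      ≈⟨ +-congˡ (trans (+-cong (-‿inverseʳ _) (-‿inverseʳ _)) (+-identityˡ 0#)) ⟩
    F + 0#
      ≈⟨ +-identityʳ F ⟩
    F ∎

  module SyntheticDivision (f : Poly2) (d : ℕ) (β₀ β₁ : Carrier) where

    -- fromTop t is row d ∸ t of the quotient: q_d = 0 and q_i = f_{i+1} + (β₀ + β₁Y) q_{i+1}.
    fromTop : ℕ → Series
    fromTop zero    j = 0#
    fromTop (suc t) j = f (d ∸ t) j + (β₀ * fromTop t j + β₁ * mulYₛ (fromTop t) j)

    quotient : Poly2
    quotient i = fromTop (d ∸ i)

    remainder : Series
    remainder j = f 0 j + (β₀ * quotient 0 j + β₁ * mulY quotient 0 j)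

    quotient-top : ∀ i j → d ≤ i → quotient i j ≈ 0#
    quotient-top i j d≤i = reflexive (≡.cong (λ t → fromTop t j) (ℕₚ.m≤n⇒m∸n≡0 d≤i))

    mulY-quotient-top : ∀ i j → d ≤ i → mulY quotient i j ≈ 0#
    mulY-quotient-top i zero    _   = refl
    mulY-quotient-top i (suc j) d≤i = quotient-top i j d≤i

    quotient-step : ∀ i j → i < d →
      quotient i j ≈ f (suc i) j + (β₀ * quotient (suc i) j + β₁ * mulY quotient (suc i) j)
    quotient-step i j i<d = trans (reflexive (≡.cong (λ t → fromTop t j) (∸-suc i<d)))
                                  (+-congʳ (reflexive (≡.cong (λ i′ → f i′ j) (ℕₚ.m∸[m∸n]≡n i<d))))

    module _ (f≤d : TotDeg≤ f d) where

      fromTop-vanish : ∀ t j → t ≤ j → fromTop t j ≈ 0#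
      fromTop-vanish zero    j       _         = refl
      fromTop-vanish (suc t) (suc j) (s≤s t≤j) = begin
        f (d ∸ t) (suc j) + (β₀ * fromTop t (suc j) + β₁ * fromTop t j)
          ≈⟨ +-cong (f≤d (d ∸ t) (suc j) (m<m∸n+[1+o] d t≤j))
                    (+-cong (*-congˡ (fromTop-vanish t (suc j) (ℕₚ.m≤n⇒m≤1+n t≤j))) (*-congˡ (fromTop-vanish t j t≤j))) ⟩
        0# + (β₀ * 0# + β₁ * 0#)
          ≈⟨ trans (+-identityˡ _) (trans (+-cong (zeroʳ β₀) (zeroʳ β₁)) (+-identityˡ 0#)) ⟩
        0# ∎

      quotient-degree : TotDeg≤ quotient d
      quotient-degree i j d<i+j = fromTop-vanish (d ∸ i) j (ℕₚ.m≤n+o⇒m∸n≤o d i (ℕₚ.<⇒≤ d<i+j))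

      division : f ≈₂ (mul2 (linearFactor β₀ β₁) quotient +₂ constX remainder)
      division i j = sym (begin
        mul2 (linearFactor β₀ β₁) q i j + constX remainder i j
          ≈⟨ +-congʳ (mul2-linearˡ (linearFactor β₀ β₁) q (proj₁ (linearFactor-degree β₀ β₁)) i j) ⟩
        (- β₀ * q i j + - β₁ * mulY q i j) + 1# * mulX q i j + constX remainder i j
          ≈⟨ collapse i ⟩
        f i j ∎)
        where
          q : Poly2
          q = quotient
          collapse : ∀ i → (- β₀ * q i j + - β₁ * mulY q i j) + 1# * mulX q i j + constX remainder i j ≈ f i j
          collapse zero = begin
            (- β₀ * q 0 j + - β₁ * mulY q 0 j) + 1# * 0# + remainder j
              ≈⟨ +-congʳ (trans (+-congˡ (zeroʳ 1#)) (+-identityʳ _)) ⟩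
            (- β₀ * q 0 j + - β₁ * mulY q 0 j) + (f 0 j + (β₀ * q 0 j + β₁ * mulY q 0 j))
              ≈⟨ -‿cancel (f 0 j) β₀ β₁ (q 0 j) (mulY q 0 j) ⟩
            f 0 j ∎
          collapse (suc i) with i ℕ.<? d
          ... | yes i<d = trans (+-identityʳ _)
                            (trans (+-congˡ (trans (*-identityˡ _) (quotient-step i j i<d))) (-‿cancel _ β₀ β₁ _ _))
          ... | no  i≮d = begin
            (- β₀ * q (suc i) j + - β₁ * mulY q (suc i) j) + 1# * q i j + 0#
              ≈⟨ +-identityʳ _ ⟩
            (- β₀ * q (suc i) j + - β₁ * mulY q (suc i) j) + 1# * q i j
              ≈⟨ +-cong (+-cong (*-congˡ (quotient-top (suc i) j (ℕₚ.m≤n⇒m≤1+n d≤i)))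
                                (*-congˡ (mulY-quotient-top (suc i) j (ℕₚ.m≤n⇒m≤1+n d≤i))))
                        (*-congˡ (quotient-top i j d≤i)) ⟩
            (- β₀ * 0# + - β₁ * 0#) + 1# * 0#
              ≈⟨ trans (+-cong (+-cong (zeroʳ _) (zeroʳ _)) (zeroʳ _)) (trans (+-identityʳ _) (+-identityˡ 0#)) ⟩
            0#
              ≈⟨ sym (TotDeg≤-rows f≤d (suc i) j (s≤s d≤i)) ⟩
            f (suc i) j ∎
            where
              d≤i : d ≤ i
              d≤i = ℕₚ.≮⇒≥ i≮d

  linear-root⇒linear-factor : ∀ d f β₀ β₁ → TotDeg≤ f d → (∀ n → subst2 d f (linₛ β₀ β₁) n ≈ 0#) →
    Σ Poly2 λ q → TotDeg≤ q d × f ≈₂ mul2 (linearFactor β₀ β₁) q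
  linear-root⇒linear-factor d f β₀ β₁ f≤d β-root =
    quotient , quotient-degree f≤d ,
    λ i j → trans (division f≤d i j) (trans (+-congˡ (remainder-vanishes i j)) (+-identityʳ _))
    where
      open SyntheticDivision f d β₀ β₁
      β : Series
      β = linₛ β₀ β₁
      remainder≈0 : ∀ n → remainder n ≈ 0#
      remainder≈0 n = begin
        remainder n
          ≈⟨ sym (trans (+-identityˡ _) (subst2-constX (suc d) remainder β n)) ⟩
        0# + subst2 (suc d) (constX remainder) β n
          ≈⟨ +-congʳ (sym (subst2-mul2-linₛ-root d (linearFactor β₀ β₁) quotient β₀ β₁
               (proj₁ (linearFactor-degree β₀ β₁)) (λ j → quotient-top (suc d) j (ℕₚ.n≤1+n d))
               (-x+1#*x≈0 β₀) (-x+1#*x≈0 β₁) n)) ⟩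
        subst2 (suc d) (mul2 (linearFactor β₀ β₁) quotient) β n + subst2 (suc d) (constX remainder) β n
          ≈⟨ sym (subst2-+₂ (suc d) _ _ β n) ⟩
        subst2 (suc d) (mul2 (linearFactor β₀ β₁) quotient +₂ constX remainder) β n
          ≈⟨ sym (subst2-cong (suc d) β n (division f≤d)) ⟩
        subst2 (suc d) f β n
          ≈⟨ subst2-extend f β n (ℕₚ.n≤1+n d) (TotDeg≤-rows f≤d) ⟩
        subst2 d f β n
          ≈⟨ β-root n ⟩
        0# ∎
      remainder-vanishes : ∀ i j → constX remainder i j ≈ 0#
      remainder-vanishes zero    j = remainder≈0 j
      remainder-vanishes (suc i) j = refl

  linear-factor⇒linear-root : ∀ d f g h α → TotDeg≤ f d → ¬ (f d 0 ≈ 0#) →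
    TotDeg≤ g 1 → IsPolynomial h → f ≈₂ mul2 g h → eval2 1 g α 0# ≈ 0# →
    Σ Carrier λ β₁ → ∀ n → subst2 d f (linₛ α β₁) n ≈ 0#
  linear-factor⇒linear-root d f g h α f≤d fd0≉0 g≤1 (e , h≤e) f≈gh g-root = β₁ , β-root
    where
      root₀ : g 0 0 + g 1 0 * α ≈ 0#
      root₀ = trans (sym (eval2-linear g α)) g-root
      g₁₀≉0 : ¬ (g 1 0 ≈ 0#)
      g₁₀≉0 g₁₀≈0 = fd0≉0 (trans (f≈gh d 0) (mul2-Y-divisible g h g≤1 g₀₀≈0 g₁₀≈0 d))
        where
          g₀₀≈0 : g 0 0 ≈ 0#
          g₀₀≈0 = trans (sym (+-identityʳ _)) (trans (+-congˡ (sym (trans (*-congʳ g₁₀≈0) (zeroˡ α)))) root₀)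
      g₁₀⁻¹ β₁ : Carrier
      g₁₀⁻¹ = proj₁ (inverse (g 1 0) g₁₀≉0)
      β₁ = - (g 0 1 * g₁₀⁻¹)
      root₁ : g 0 1 + g 1 0 * β₁ ≈ 0#
      root₁ = begin
        g 0 1 + g 1 0 * - (g 0 1 * g₁₀⁻¹)   ≈⟨ +-congˡ (sym (-‿distribʳ-* _ _)) ⟩
        g 0 1 + - (g 1 0 * (g 0 1 * g₁₀⁻¹)) ≈⟨ +-congˡ (-‿cong (trans
                                                 (solve 3 (λ a b w → a :* (b :* w) := b :* (a :* w)) refl (g 1 0) (g 0 1) g₁₀⁻¹)
                                                 (trans (*-congˡ (proj₂ (inverse (g 1 0) g₁₀≉0))) (*-identityʳ _)))) ⟩
        g 0 1 + - g 0 1                     ≈⟨ -‿inverseʳ _ ⟩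
        0#                                  ∎
      D : ℕ
      D = e ℕ.+ d
      β : Series
      β = linₛ α β₁
      β-root : ∀ n → subst2 d f β n ≈ 0#
      β-root n = begin
        subst2 d f β n
          ≈⟨ sym (subst2-extend f β n (ℕₚ.≤-trans (ℕₚ.m≤n+m d e) (ℕₚ.n≤1+n D))
                   (TotDeg≤-rows f≤d)) ⟩
        subst2 (suc D) f β n
          ≈⟨ subst2-cong (suc D) β n f≈gh ⟩
        subst2 (suc D) (mul2 g h) β n
          ≈⟨ subst2-mul2-linₛ-root D g h α β₁ g≤1
               (λ j → TotDeg≤-rows h≤e (suc D) j (s≤s (ℕₚ.m≤m+n e d))) root₀ root₁ n ⟩
        0# ∎

  truncated-root⇒root : ∀ d f {s} β₀ β₁ → TotDeg≤ f d → s ≈ₛ linₛ β₀ β₁ upTo d →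
    (∀ n → subst2 d f s n ≈ 0#) → ∀ n → subst2 d f (linₛ β₀ β₁) n ≈ 0#
  truncated-root⇒root d f β₀ β₁ f≤d s≈β s-root n with n ℕ.≤? d
  ... | yes n≤d = trans (sym (subst2-cong-upTo d f s≈β n n≤d)) (s-root n)
  ... | no  n≰d = subst2-linₛ-vanish f β₀ β₁ f≤d n (ℕₚ.≰⇒> n≰d)

  truncation⇒≈linₛ : ∀ {d s α u₀ u₁} → s 0 ≈ α → (∀ r → r ≤ d → addLin s u₀ u₁ r ≈ 0#) →
    s ≈ₛ linₛ α (s 1) upTo d
  truncation⇒≈linₛ s₀≈α truncation zero          _   = s₀≈α
  truncation⇒≈linₛ s₀≈α truncation (suc zero)    _   = refl
  truncation⇒≈linₛ s₀≈α truncation (suc (suc r)) r≤d = truncation (suc (suc r)) r≤d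

  linear-root⇒truncation : ∀ d f {s α β₁} → s 0 ≈ α → ¬ (derivX₀ d f α ≈ 0#) →
    (∀ n → subst2 d f s n ≈ 0#) → (∀ n → subst2 d f (linₛ α β₁) n ≈ 0#) →
    ∀ r → addLin s (- s 0) (- s 1) r ≈ 0#
  linear-root⇒truncation d f s₀≈α f′≉0 s-root β-root zero          = -‿inverseʳ _
  linear-root⇒truncation d f s₀≈α f′≉0 s-root β-root (suc zero)    = -‿inverseʳ _
  linear-root⇒truncation d f s₀≈α f′≉0 s-root β-root (suc (suc r)) =
    roots-unique d f s₀≈α refl f′≉0 s-root β-root (suc (suc r)) (suc (suc r)) ℕₚ.≤-refl

  Adjoin-neg : ∀ {ℓ′} {k : Carrier → Set ℓ′} {α x} → Adjoin k α x → Adjoin k α (- x)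
  Adjoin-neg x∈kα L L-subfield k⊆L α∈L = IsSubfield.has- L-subfield (x∈kα L L-subfield k⊆L α∈L)

proposition2p4 : ∀ {c ℓ ℓ' : Level} (K : Field c ℓ) →
    let open Field K hiding (zero) in let open FieldTheory K in
    IsAlgebraicallyClosed →
    (k : Carrier → Set ℓ') → IsSubfield k → (∀ x → IsAlgebraicOver k x) →
    (f : Poly2) (d : ℕ) → (∀ i j → k (f i j)) →
    TotDeg≡ f d → ¬ (f d 0 ≈ 0#) →
    (α₀ : Carrier) →
    Σ≤ d (λ i → f i 0 * pow α₀ i) ≈ 0# →
    ¬ (Σ< d (λ i → (suc i · f (suc i) 0) * pow α₀ i) ≈ 0#) →
    (α̃ : Series) → (∀ n → Adjoin k α₀ (α̃ n)) → α̃ 0 ≈ α₀ →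
    (∀ n → subst2 d f α̃ n ≈ 0#) →
    ((Σ Poly2 λ g → Σ Poly2 λ h →
        TotDeg≡ g 1 × IsPolynomial h × (f ≈₂ mul2 g h) × (eval2 1 g α₀ 0# ≈ 0#))
     ⇔
     (Σ Carrier λ u₀₀ → Σ Carrier λ u₀₁ →
        Adjoin k α₀ u₀₀ × Adjoin k α₀ u₀₁ ×
        (∀ r → r ≤ d → addLin α̃ u₀₀ u₀₁ r ≈ 0#)))
proposition2p4 K _ _ _ _ f d _ (f≤d , _) fd0≉0 α₀ _ f′≉0 α̃ α̃∈kα₀ α̃₀≈α₀ α̃-root = mk⇔
  (λ (g , h , (g≤1 , _) , h-poly , f≈gh , g-root) →
    let (β₁ , β-root) = linear-factor⇒linear-root d f g h α₀ f≤d fd0≉0 g≤1 h-poly f≈gh g-root in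
    - α̃ 0 , - α̃ 1 , Adjoin-neg (α̃∈kα₀ 0) , Adjoin-neg (α̃∈kα₀ 1) ,
    λ r _ → linear-root⇒truncation d f α̃₀≈α₀ derivX₀≉0 α̃-root β-root r)
  (λ (_ , _ , _ , _ , truncation) →
    let β-root = truncated-root⇒root d f α₀ (α̃ 1) f≤d (truncation⇒≈linₛ α̃₀≈α₀ truncation) α̃-root
        (q , q≤d , f≈gq) = linear-root⇒linear-factor d f α₀ (α̃ 1) f≤d β-root in
    linearFactor α₀ (α̃ 1) , q , linearFactor-degree α₀ (α̃ 1) , (d , q≤d) , f≈gq , linearFactor-root α₀ (α̃ 1))
  where
    open Field K hiding (zero)
    open FieldLemmas K
    derivX₀≉0 : ¬ (derivX₀ d f α₀ ≈ 0#)
    derivX₀≉0 f′≈0 = f′≉0 (trans (sym (derivX₀-expand d f α₀)) f′≈0)
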